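{- Let $(j:A\to C,k:B\to C)$ and $(j':B\to C',k':D\to C')$ be bipartite cospans in $\mathsf{Pos}$, and let $(i:C\to E,l:C'\to E)$ be the cocomma of the span $C\xleftarrow{k}B\xrightarrow{j'}C'$. Then the cospan $(i\circ j,l\circ k')$ is bipartite.
   Context: $\mathsf{Pos}$ is the category of posets and monotone maps. The cocomma of a span $C\xleftarrow{k}B\xrightarrow{j'}C'$ is a cospan $(i,l)$ into $E$ with $ik\le lj'$ pointwise, universal among such cospans (unique, monotone factorisation). For a cospan $(j:A\to C,k:B\to C)$, let $\mathrm{Col}(j,k)$ be the poset on the disjoint union $A\sqcup B$ ordered by the orders of $A$ and $B$ together with $a\le b$ iff $j(a)\le k(b)$ (and never $b\le a$); this is the cocomma of the comma of $(j,k)$, and there is a canonical monotone map $\mathrm{Col}(j,k)\to C$ given by $j$ on $A$ and $k$ on $B$. The cospan $(j,k)$ is bipartite if this canonical map is fully faithful, i.e. order-reflecting (an order-embedding). -}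

module Defs where

open import Level using (Level; _⊔_; Lift) renaming (suc to lsuc)
open import Data.Empty using (⊥)
open import Data.Sum using (_⊎_; inj₁; inj₂)
open import Data.Product using (Σ; _×_)
open import Relation.Binary.Bundles using (Poset)
open import Relation.Binary.Morphism.Bundles using (PosetHomomorphism; mkPosetHomo)

module _ {c ℓ₁ ℓ₂ : Level} where

  Hom : Poset c ℓ₁ ℓ₂ → Poset c ℓ₁ ℓ₂ → Set (c ⊔ ℓ₁ ⊔ ℓ₂)
  Hom P Q = PosetHomomorphism P Q

  app : {P Q : Poset c ℓ₁ ℓ₂} → Hom P Q → Poset.Carrier P → Poset.Carrier Q
  app f = PosetHomomorphism.⟦_⟧ f

  _∘ₘ_ : {P Q R : Poset c ℓ₁ ℓ₂} → Hom Q R → Hom P Q → Hom P R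
  _∘ₘ_ {P} {Q} {R} g f =
    mkPosetHomo P R (λ x → app g (app f x))
      (λ x≤y → PosetHomomorphism.mono g (PosetHomomorphism.mono f x≤y))

  _≤ₘ_ : {P Q : Poset c ℓ₁ ℓ₂} → Hom P Q → Hom P Q → Set (c ⊔ ℓ₂)
  _≤ₘ_ {P} {Q} f g = ∀ x → Poset._≤_ Q (app f x) (app g x)

  _≈ₘ_ : {P Q : Poset c ℓ₁ ℓ₂} → Hom P Q → Hom P Q → Set (c ⊔ ℓ₁)
  _≈ₘ_ {P} {Q} f g = ∀ x → Poset._≈_ Q (app f x) (app g x)

  IsCocomma : {B C C' E : Poset c ℓ₁ ℓ₂} →
              Hom B C → Hom B C' → Hom C E → Hom C' E → Set (lsuc (c ⊔ ℓ₁ ⊔ ℓ₂))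
  IsCocomma {B} {C} {C'} {E} k j' i l =
    ((i ∘ₘ k) ≤ₘ (l ∘ₘ j')) ×
    ((X : Poset c ℓ₁ ℓ₂) (i' : Hom C X) (l' : Hom C' X) →
       (i' ∘ₘ k) ≤ₘ (l' ∘ₘ j') →
       Σ (Hom E X) λ h →
         ((h ∘ₘ i) ≈ₘ i') × ((h ∘ₘ l) ≈ₘ l') ×
         ((h' : Hom E X) → (h' ∘ₘ i) ≈ₘ i' → (h' ∘ₘ l) ≈ₘ l' → h' ≈ₘ h))

  ColLe : {A B C : Poset c ℓ₁ ℓ₂} → Hom A C → Hom B C →
          (Poset.Carrier A ⊎ Poset.Carrier B) →
          (Poset.Carrier A ⊎ Poset.Carrier B) → Set ℓ₂
  ColLe {A} {B} {C} j k (inj₁ a) (inj₁ a') = Poset._≤_ A a a'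
  ColLe {A} {B} {C} j k (inj₂ b) (inj₂ b') = Poset._≤_ B b b'
  ColLe {A} {B} {C} j k (inj₁ a) (inj₂ b)  = Poset._≤_ C (app j a) (app k b)
  ColLe {A} {B} {C} j k (inj₂ b) (inj₁ a)  = Lift ℓ₂ ⊥

  colMap : {A B C : Poset c ℓ₁ ℓ₂} → Hom A C → Hom B C →
           (Poset.Carrier A ⊎ Poset.Carrier B) → Poset.Carrier C
  colMap j k (inj₁ a) = app j a
  colMap j k (inj₂ b) = app k b

  IsBipartite : {A B C : Poset c ℓ₁ ℓ₂} → Hom A C → Hom B C → Set (c ⊔ ℓ₂)
  IsBipartite {A} {B} {C} j k =
    ∀ x y → Poset._≤_ C (colMap j k x) (colMap j k y) → ColLe j k x y

-- The inclusions of C and C' into the ordinal sum C ⊕ C' (all of C below all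
-- of C') trivially satisfy the cocomma inequality, so they factor through E.
-- Hence i and l reflect the order and no l c' lies below an i c. Now a ≤ a'
-- and d ≤ d' are reflected through i ∘ j and l ∘ k' by bipartiteness of the
-- two cospans, i (j a) ≤ l (k' d) is exactly what Col asks for, and
-- l (k' d) ≤ i (j a) never holds.
module Submission where

open import Defs
open import Level using (Level; Lift; lift; _⊔_)
open import Data.Empty using (⊥)
open import Data.Product using (proj₁; proj₂)
open import Data.Sum using (_⊎_; inj₁; inj₂)
open import Data.Unit.Polymorphic using (⊤)
open import Relation.Binary.Bundles using (Poset)
open import Relation.Binary.Core using (Rel; _⇒_)
open import Relation.Binary.Definitions using (Reflexive; Symmetric; Transitive; Antisymmetric)
open import Relation.Binary.Morphism.Bundles using (PosetHomomorphism; mkPosetHomo)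
open import Relation.Nullary using (¬_)
import Relation.Binary.Reasoning.PartialOrder as ≤-Reasoning

module _ {c ℓ₁ ℓ₂ : Level} where

  OrderReflecting : {P Q : Poset c ℓ₁ ℓ₂} → Hom P Q → Set (c ⊔ ℓ₂)
  OrderReflecting {P} {Q} f = ∀ x y → Poset._≤_ Q (app f x) (app f y) → Poset._≤_ P x y

  reflecting-of-∘≈ : {P Q R : Poset c ℓ₁ ℓ₂} (h : Hom Q R) {g : Hom P Q} {f : Hom P R} →
                     (h ∘ₘ g) ≈ₘ f → OrderReflecting f → OrderReflecting g
  reflecting-of-∘≈ {R = R} h {g} {f} hg≈f f-refl x y gx≤gy = f-refl x y (begin
    app f x         ≈⟨ hg≈f x ⟨
    app h (app g x) ≤⟨ PosetHomomorphism.mono h gx≤gy ⟩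
    app h (app g y) ≈⟨ hg≈f y ⟩
    app f y         ∎)
    where open ≤-Reasoning R

  bipartite⇒reflectingˡ : {A B C : Poset c ℓ₁ ℓ₂} {j : Hom A C} {k : Hom B C} →
                          IsBipartite j k → OrderReflecting j
  bipartite⇒reflectingˡ bip a a' = bip (inj₁ a) (inj₁ a')

  bipartite⇒reflectingʳ : {A B C : Poset c ℓ₁ ℓ₂} {j : Hom A C} {k : Hom B C} →
                          IsBipartite j k → OrderReflecting k
  bipartite⇒reflectingʳ bip b b' = bip (inj₂ b) (inj₂ b')

  module OrdinalSum (P Q : Poset c ℓ₁ ℓ₂) where
    private
      module P = Poset P
      module Q = Poset Q

    -- Not Data.Sum.Relation.Binary.LeftOrder: its relations live at levels
    -- raised by c, so it is not a Poset c ℓ₁ ℓ₂ as IsCocomma requires.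
    _≈_ : Rel (P.Carrier ⊎ Q.Carrier) ℓ₁
    inj₁ x ≈ inj₁ y = x P.≈ y
    inj₂ x ≈ inj₂ y = x Q.≈ y
    _      ≈ _      = Lift ℓ₁ ⊥

    _≤_ : Rel (P.Carrier ⊎ Q.Carrier) ℓ₂
    inj₁ x ≤ inj₁ y = x P.≤ y
    inj₂ x ≤ inj₂ y = x Q.≤ y
    inj₁ _ ≤ inj₂ _ = ⊤
    inj₂ _ ≤ inj₁ _ = Lift ℓ₂ ⊥

    ≈-refl : Reflexive _≈_
    ≈-refl {inj₁ _} = P.Eq.refl
    ≈-refl {inj₂ _} = Q.Eq.refl

    ≈-sym : Symmetric _≈_
    ≈-sym {inj₁ _} {inj₁ _} = P.Eq.sym
    ≈-sym {inj₂ _} {inj₂ _} = Q.Eq.sym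

    ≈-trans : Transitive _≈_
    ≈-trans {inj₁ _} {inj₁ _} {inj₁ _} = P.Eq.trans
    ≈-trans {inj₂ _} {inj₂ _} {inj₂ _} = Q.Eq.trans

    ≤-reflexive : _≈_ ⇒ _≤_
    ≤-reflexive {inj₁ _} {inj₁ _} = P.reflexive
    ≤-reflexive {inj₂ _} {inj₂ _} = Q.reflexive

    ≤-trans : Transitive _≤_
    ≤-trans {inj₁ _} {inj₁ _} {inj₁ _} = P.trans
    ≤-trans {inj₂ _} {inj₂ _} {inj₂ _} = Q.trans
    ≤-trans {inj₁ _} {inj₁ _} {inj₂ _} _ _ = _
    ≤-trans {inj₁ _} {inj₂ _} {inj₂ _} _ _ = _
    ≤-trans {inj₁ _} {inj₂ _} {inj₁ _} _ ()
    ≤-trans {inj₂ _} {inj₁ _} {_}      ()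

    ≤-antisym : Antisymmetric _≈_ _≤_
    ≤-antisym {inj₁ _} {inj₁ _} = P.antisym
    ≤-antisym {inj₂ _} {inj₂ _} = Q.antisym
    ≤-antisym {inj₁ _} {inj₂ _} _ ()
    ≤-antisym {inj₂ _} {inj₁ _} ()

    poset : Poset c ℓ₁ ℓ₂
    poset = record
      { Carrier        = P.Carrier ⊎ Q.Carrier
      ; _≈_            = _≈_
      ; _≤_            = _≤_
      ; isPartialOrder = record
        { isPreorder = record
          { isEquivalence = record
            { refl  = λ {x} → ≈-refl {x}
            ; sym   = λ {x} {y} → ≈-sym {x} {y}
            ; trans = λ {x} {y} {z} → ≈-trans {x} {y} {z}
            }
          ; reflexive     = λ {x} {y} → ≤-reflexive {x} {y}
          ; trans         = λ {x} {y} {z} → ≤-trans {x} {y} {z}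
          }
        ; antisym    = λ {x} {y} → ≤-antisym {x} {y}
        }
      }

    ι₁ : Hom P poset
    ι₁ = mkPosetHomo P poset inj₁ (λ p → p)

    ι₂ : Hom Q poset
    ι₂ = mkPosetHomo Q poset inj₂ (λ p → p)

    ι₁-reflecting : OrderReflecting ι₁
    ι₁-reflecting _ _ p = p

    ι₂-reflecting : OrderReflecting ι₂
    ι₂-reflecting _ _ p = p

  module Cocomma {B C C' E : Poset c ℓ₁ ℓ₂}
                 (k : Hom B C) (j' : Hom B C') (i : Hom C E) (l : Hom C' E)
                 (cocomma : IsCocomma k j' i l) where
    open OrdinalSum C C'

    private
      comparison : Hom E poset
      comparison = proj₁ (proj₂ cocomma poset ι₁ ι₂ (λ _ → _))

      comparison∘i≈ι₁ : (comparison ∘ₘ i) ≈ₘ ι₁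
      comparison∘i≈ι₁ = proj₁ (proj₂ (proj₂ cocomma poset ι₁ ι₂ (λ _ → _)))

      comparison∘l≈ι₂ : (comparison ∘ₘ l) ≈ₘ ι₂
      comparison∘l≈ι₂ = proj₁ (proj₂ (proj₂ (proj₂ cocomma poset ι₁ ι₂ (λ _ → _))))

    i-reflecting : OrderReflecting i
    i-reflecting = reflecting-of-∘≈ comparison {i} {ι₁} comparison∘i≈ι₁ ι₁-reflecting

    l-reflecting : OrderReflecting l
    l-reflecting = reflecting-of-∘≈ comparison {l} {ι₂} comparison∘l≈ι₂ ι₂-reflecting

    ¬l≤i : ∀ c' x → ¬ Poset._≤_ E (app l c') (app i x)
    ¬l≤i c' x lc'≤ix with begin
      inj₂ c'                    ≈⟨ comparison∘l≈ι₂ c' ⟨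
      app comparison (app l c')  ≤⟨ PosetHomomorphism.mono comparison lc'≤ix ⟩
      app comparison (app i x)   ≈⟨ comparison∘i≈ι₁ x ⟩
      inj₁ x                     ∎
      where open ≤-Reasoning poset
    ... | ()

proposition3p13 : {c ℓ₁ ℓ₂ : Level} {A B C C' D E : Poset c ℓ₁ ℓ₂}
    (j : Hom A C) (k : Hom B C) (j' : Hom B C') (k' : Hom D C')
    (i : Hom C E) (l : Hom C' E) →
    IsBipartite j k → IsBipartite j' k' → IsCocomma k j' i l →
    IsBipartite (i ∘ₘ j) (l ∘ₘ k')
proposition3p13 j k j' k' i l bip bip' cocomma = reflects
  where
  open Cocomma k j' i l cocomma

  reflects : IsBipartite (i ∘ₘ j) (l ∘ₘ k')
  reflects (inj₁ a) (inj₁ a') ija≤ija' =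
    bipartite⇒reflectingˡ bip a a' (i-reflecting _ _ ija≤ija')
  reflects (inj₂ d) (inj₂ d') lk'd≤lk'd' =
    bipartite⇒reflectingʳ bip' d d' (l-reflecting _ _ lk'd≤lk'd')
  reflects (inj₁ a) (inj₂ d) ija≤lk'd = ija≤lk'd
  reflects (inj₂ d) (inj₁ a) lk'd≤ija = lift (¬l≤i (app k' d) (app j a) lk'd≤ija)
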